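{- For every integer $r\ge2$, let $B_r$ be a finite constant and $G_{r,1},G_{r,2},\ldots$ graphs such that for every $m\ge1$: $\omega(G_{r,m})=r$, $\chi(G_{r,m})\ge m$, and every induced subgraph $H$ of $G_{r,m}$ with $\omega(H)\le r-1$ satisfies $\chi(H)\le B_r$; let $T_r$ be a connected triangle-free graph with $\omega(T_r)=2$ and $\chi(T_r)=r$. Set $X_{r,m}=G_{r,m}\cup T_r$ (disjoint union), $\mathcal{C}_r=\{X_{r,m}:m\ge1\}$, $\mathcal{C}=\bigcup_{r\ge2}\mathcal{C}_r$, and $\mathcal{H}_r=\operatorname{Ind}(\mathcal{C}_r)$. Then for every integer $r\ge2$, the class $\mathcal{C}\cap\mathcal{H}_r$ is not polynomially $\chi$-bounded.
   Context: All graphs are finite, simple and undirected; $\chi$ denotes chromatic number and $\omega$ clique number. For a graph class $\mathcal{A}$, $\operatorname{Ind}(\mathcal{A})$ is the set of all graphs that are induced subgraphs of some member of $\mathcal{A}$. A class $\mathcal{F}$ (not necessarily hereditary) is polynomially $\chi$-bounded if there is a polynomial $p$ such that for every $G\in\mathcal{F}$ and every induced subgraph $H$ of $G$, $\chi(H)\le p(\omega(H))$. -}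

module Defs where

open import Data.Nat using (ℕ; zero; suc; _+_; _*_; _≤_; _∸_)
open import Data.Fin using (Fin; splitAt)
open import Data.Bool using (Bool; true; false)
open import Data.Sum using (_⊎_; inj₁; inj₂)
open import Data.Product using (Σ; _×_; _,_; ∃)
open import Data.List using (List; []; _∷_)
open import Data.Empty using (⊥)
open import Relation.Nullary using (¬_)
open import Relation.Binary.PropositionalEquality using (_≡_; _≢_; refl)
open import Function.Definitions using (Injective)

record Graph : Set where
  field
    n      : ℕ
    adj    : Fin n → Fin n → Bool
    sym    : ∀ u v → adj u v ≡ adj v u
    irrefl : ∀ v → adj v v ≡ false
open Graph public

Adj : (G : Graph) → Fin (n G) → Fin (n G) → Set
Adj G u v = adj G u v ≡ true

Colorable : Graph → ℕ → Set
Colorable G k = Σ (Fin (n G) → Fin k) λ c → ∀ u v → Adj G u v → c u ≢ c v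

IsChromaticNumber : Graph → ℕ → Set
IsChromaticNumber G k = Colorable G k × (∀ j → Colorable G j → k ≤ j)

ChiAtLeast : Graph → ℕ → Set
ChiAtLeast G m = ∀ j → Colorable G j → m ≤ j

-- a clique of size k: k pairwise adjacent (hence distinct) vertices
HasClique : Graph → ℕ → Set
HasClique G k = Σ (Fin k → Fin (n G)) λ f → ∀ i j → i ≢ j → Adj G (f i) (f j)

IsCliqueNumber : Graph → ℕ → Set
IsCliqueNumber G k = HasClique G k × (∀ j → HasClique G j → j ≤ k)

TriangleFree : Graph → Set
TriangleFree G = ¬ HasClique G 3

data Reachable (G : Graph) : Fin (n G) → Fin (n G) → Set where
  here : ∀ {u} → Reachable G u u
  step : ∀ {u v w} → Adj G u v → Reachable G v w → Reachable G u w

Connected : Graph → Set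
Connected G = ∀ u v → Reachable G u v

InducedSub : Graph → Graph → Set
InducedSub H G = Σ (Fin (n H) → Fin (n G)) λ f →
  Injective _≡_ _≡_ f × (∀ u v → adj G (f u) (f v) ≡ adj H u v)

private
  uadj : ∀ {a b} → (Fin a → Fin a → Bool) → (Fin b → Fin b → Bool)
       → Fin (a + b) → Fin (a + b) → Bool
  uadj {a} A B u v with splitAt a u | splitAt a v
  ... | inj₁ x | inj₁ y = A x y
  ... | inj₂ x | inj₂ y = B x y
  ... | inj₁ _ | inj₂ _ = false
  ... | inj₂ _ | inj₁ _ = false

  usym : ∀ (G H : Graph) u v →
         uadj (adj G) (adj H) u v ≡ uadj (adj G) (adj H) v u
  usym G H u v with splitAt (n G) u | splitAt (n G) v
  ... | inj₁ x | inj₁ y = sym G x y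
  ... | inj₂ x | inj₂ y = sym H x y
  ... | inj₁ _ | inj₂ _ = refl
  ... | inj₂ _ | inj₁ _ = refl

  uirr : ∀ (G H : Graph) v → uadj (adj G) (adj H) v v ≡ false
  uirr G H v with splitAt (n G) v
  ... | inj₁ x = irrefl G x
  ... | inj₂ x = irrefl H x

_∪G_ : Graph → Graph → Graph
G ∪G H = record
  { n      = n G + n H
  ; adj    = uadj (adj G) (adj H)
  ; sym    = usym G H
  ; irrefl = uirr G H
  }

Class : Set₁
Class = Graph → Set

Ind : Class → Class
Ind 𝒜 H = Σ Graph λ A → 𝒜 A × InducedSub H A

_∩C_ : Class → Class → Class
(𝒜 ∩C ℬ) G = 𝒜 G × ℬ G

-- polynomials with natural-number coefficients c₀ ∷ c₁ ∷ …
Poly : Set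
Poly = List ℕ

eval : Poly → ℕ → ℕ
eval []       x = 0
eval (c ∷ cs) x = c + x * eval cs x

PolyChiBounded : Class → Set
PolyChiBounded ℱ = Σ Poly λ p → ∀ G → ℱ G → ∀ H → InducedSub H G →
  ∀ w → IsCliqueNumber H w → Colorable H (eval p w)

module Construction (G : ℕ → ℕ → Graph) (T : ℕ → Graph) where

  X : ℕ → ℕ → Graph
  X r m = G r m ∪G T r

  𝒞_ : ℕ → Class
  (𝒞 r) Y = Σ ℕ λ m → (1 ≤ m) × (Y ≡ X r m)

  𝒞all : Class
  𝒞all Y = Σ ℕ λ r → (2 ≤ r) × (𝒞 r) Y

  ℋ_ : ℕ → Class
  ℋ r = Ind (𝒞 r)

{-# OPTIONS --safe #-}
-- A polynomial bound p would colour every member X_{r,m} of 𝒞_r (which lies in 𝒞 ∩ ℋ_r,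
-- being an induced subgraph of itself) with p(ω(X_{r,m})) colours.  A clique of a
-- disjoint union lies in one of the two parts, so ω(X_{r,m}) = max(r, 2) = r, while
-- X_{r,m} contains G_{r,m}, which needs at least m colours; m = p(r) + 1 is impossible.
module Submission where

open import Defs hiding (sym)
open import Data.Nat using (ℕ; zero; suc; _+_; _≤_; _∸_; _⊔_; s≤s; z≤n)
open import Data.Nat.Properties using (≤-trans; ≤-total; 1+n≰n; m≥n⇒m⊔n≡m; m≤n⇒m⊔n≡n; m≤m⊔n; m≤n⊔m)
open import Data.Fin using (Fin; zero; suc; splitAt; _↑ˡ_; _↑ʳ_)
open import Data.Fin.Properties using (↑ˡ-injective; ↑ʳ-injective; splitAt-↑ˡ; splitAt-↑ʳ; splitAt⁻¹-↑ˡ; splitAt⁻¹-↑ʳ)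
open import Data.Bool using (false)
open import Data.Sum using (_⊎_; inj₁; inj₂)
open import Data.Product using (Σ; ∃; _×_; _,_; proj₁; proj₂)
open import Relation.Nullary using (¬_)
open import Relation.Binary.PropositionalEquality using (_≡_; refl; sym; trans; cong₂; subst)

InducedSub-refl : ∀ {G} → InducedSub G G
InducedSub-refl = (λ u → u) , (λ eq → eq) , (λ _ _ → refl)

Colorable-induced : ∀ {H G k} → InducedSub H G → Colorable G k → Colorable H k
Colorable-induced (e , _ , adj-e) (c , proper) =
  (λ u → c (e u)) , λ u v uv → proper (e u) (e v) (trans (adj-e u v) uv)

HasClique-induced : ∀ {H G k} → InducedSub H G → HasClique H k → HasClique G k
HasClique-induced (e , _ , adj-e) (c , clique) =
  (λ i → e (c i)) , λ i j i≢j → trans (adj-e (c i) (c j)) (clique i j i≢j)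

HasClique-pullback : ∀ {H G k} ((e , _) : InducedSub H G) ((c , _) : HasClique G k)
  → (d : Fin k → Fin (n H)) → (∀ i → e (d i) ≡ c i) → HasClique H k
HasClique-pullback {G = G} (e , _ , adj-e) (c , clique) d ed≡c =
  d , λ i j i≢j → trans (sym (adj-e (d i) (d j)))
                          (trans (cong₂ (adj G) (ed≡c i) (ed≡c j)) (clique i j i≢j))

fixedω-unboundedχ⇒¬PolyChiBounded : (ℱ : Class) (w : ℕ)
  → (∀ k → Σ Graph λ Y → ℱ Y × IsCliqueNumber Y w × ¬ Colorable Y k)
  → ¬ PolyChiBounded ℱ
fixedω-unboundedχ⇒¬PolyChiBounded ℱ w witness (p , bounded)
  with witness (eval p w)
... | Y , Y∈ℱ , ω-Y , ¬colorable = ¬colorable (bounded Y Y∈ℱ Y (InducedSub-refl {Y}) w ω-Y)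

↑ˡ⊎↑ʳ : ∀ {a b} (u : Fin (a + b)) → (∃ λ x → x ↑ˡ b ≡ u) ⊎ (∃ λ y → a ↑ʳ y ≡ u)
↑ˡ⊎↑ʳ {a} u with splitAt a u in eq
... | inj₁ x = inj₁ (x , splitAt⁻¹-↑ˡ eq)
... | inj₂ y = inj₂ (y , splitAt⁻¹-↑ʳ eq)

module _ (G H : Graph) where

  adj-↑ˡ : ∀ x y → adj (G ∪G H) (x ↑ˡ n H) (y ↑ˡ n H) ≡ adj G x y
  adj-↑ˡ x y rewrite splitAt-↑ˡ (n G) x (n H) | splitAt-↑ˡ (n G) y (n H) = refl

  adj-↑ʳ : ∀ x y → adj (G ∪G H) (n G ↑ʳ x) (n G ↑ʳ y) ≡ adj H x y
  adj-↑ʳ x y rewrite splitAt-↑ʳ (n G) (n H) x | splitAt-↑ʳ (n G) (n H) y = refl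

  adj-↑ˡ-↑ʳ : ∀ x y → adj (G ∪G H) (x ↑ˡ n H) (n G ↑ʳ y) ≡ false
  adj-↑ˡ-↑ʳ x y rewrite splitAt-↑ˡ (n G) x (n H) | splitAt-↑ʳ (n G) (n H) y = refl

  adj-↑ʳ-↑ˡ : ∀ x y → adj (G ∪G H) (n G ↑ʳ x) (y ↑ˡ n H) ≡ false
  adj-↑ʳ-↑ˡ x y rewrite splitAt-↑ʳ (n G) (n H) x | splitAt-↑ˡ (n G) y (n H) = refl

  ∪G-inducedˡ : InducedSub G (G ∪G H)
  ∪G-inducedˡ = (_↑ˡ n H) , ↑ˡ-injective (n H) _ _ , adj-↑ˡ

  ∪G-inducedʳ : InducedSub H (G ∪G H)
  ∪G-inducedʳ = (n G ↑ʳ_) , ↑ʳ-injective (n G) _ _ , adj-↑ʳ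

  Adj-↑ˡ⇒↑ˡ : ∀ {x u v} → x ↑ˡ n H ≡ u → Adj (G ∪G H) u v → ∃ λ y → y ↑ˡ n H ≡ v
  Adj-↑ˡ⇒↑ˡ {x} {v = v} refl xv with ↑ˡ⊎↑ʳ {n G} {n H} v
  ... | inj₁ left = left
  ... | inj₂ (y , refl) with () ← trans (sym (adj-↑ˡ-↑ʳ x y)) xv

  Adj-↑ʳ⇒↑ʳ : ∀ {x u v} → n G ↑ʳ x ≡ u → Adj (G ∪G H) u v → ∃ λ y → n G ↑ʳ y ≡ v
  Adj-↑ʳ⇒↑ʳ {x} {v = v} refl xv with ↑ˡ⊎↑ʳ {n G} {n H} v
  ... | inj₂ right = right
  ... | inj₁ (y , refl) with () ← trans (sym (adj-↑ʳ-↑ˡ x y)) xv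

  ∪G-clique-split : ∀ {k} → HasClique (G ∪G H) k → HasClique G k ⊎ HasClique H k
  ∪G-clique-split {zero} _ = inj₁ ((λ ()) , λ ())
  ∪G-clique-split {suc k} K@(c , clique) with ↑ˡ⊎↑ʳ {n G} {n H} (c zero)
  ... | inj₁ (x , x≡c₀) =
    inj₁ (HasClique-pullback {G} {G ∪G H} ∪G-inducedˡ K (λ i → proj₁ (left i)) (λ i → proj₂ (left i)))
    where
    left : ∀ i → ∃ λ y → y ↑ˡ n H ≡ c i
    left zero    = x , x≡c₀
    left (suc i) = Adj-↑ˡ⇒↑ˡ x≡c₀ (clique zero (suc i) λ ())
  ... | inj₂ (x , x≡c₀) =
    inj₂ (HasClique-pullback {H} {G ∪G H} ∪G-inducedʳ K (λ i → proj₁ (right i)) (λ i → proj₂ (right i)))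
    where
    right : ∀ i → ∃ λ y → n G ↑ʳ y ≡ c i
    right zero    = x , x≡c₀
    right (suc i) = Adj-↑ʳ⇒↑ʳ x≡c₀ (clique zero (suc i) λ ())

  ∪G-cliqueNumber : ∀ {a b} → IsCliqueNumber G a → IsCliqueNumber H b
                  → IsCliqueNumber (G ∪G H) (a ⊔ b)
  ∪G-cliqueNumber {a} {b} (clique-G , max-G) (clique-H , max-H) = clique , maximal
    where
    clique : HasClique (G ∪G H) (a ⊔ b)
    clique with ≤-total b a
    ... | inj₁ b≤a = subst (HasClique (G ∪G H)) (sym (m≥n⇒m⊔n≡m b≤a))
                       (HasClique-induced {G} {G ∪G H} ∪G-inducedˡ clique-G)
    ... | inj₂ a≤b = subst (HasClique (G ∪G H)) (sym (m≤n⇒m⊔n≡n a≤b))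
                       (HasClique-induced {H} {G ∪G H} ∪G-inducedʳ clique-H)
    maximal : ∀ j → HasClique (G ∪G H) j → j ≤ a ⊔ b
    maximal j K with ∪G-clique-split K
    ... | inj₁ K-G = ≤-trans (max-G j K-G) (m≤m⊔n a b)
    ... | inj₂ K-H = ≤-trans (max-H j K-H) (m≤n⊔m a b)

-- Only ω(G_{r,m}) = r, χ(G_{r,m}) ≥ m and ω(T_r) = 2 are needed.
lemma3p4 : (B : ℕ → ℕ) (G : ℕ → ℕ → Graph) (T : ℕ → Graph)
    → (∀ r → 2 ≤ r → ∀ m → 1 ≤ m → IsCliqueNumber (G r m) r)
    → (∀ r → 2 ≤ r → ∀ m → 1 ≤ m → ChiAtLeast (G r m) m)
    → (∀ r → 2 ≤ r → ∀ m → 1 ≤ m → ∀ H → InducedSub H (G r m)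
         → ∀ w → IsCliqueNumber H w → w ≤ r ∸ 1 → Colorable H (B r))
    → (∀ r → 2 ≤ r → Connected (T r) × TriangleFree (T r)
         × IsCliqueNumber (T r) 2 × IsChromaticNumber (T r) r)
    → ∀ r → 2 ≤ r
    → ¬ PolyChiBounded (Construction.𝒞all G T ∩C Construction.ℋ_ G T r)
lemma3p4 _ G T ω-G χ-G _ T-props r 2≤r =
  fixedω-unboundedχ⇒¬PolyChiBounded _ r λ k → X r (suc k) , X∈𝒞∩ℋ k , ω-X k , ¬colorable-X k
  where
  open Construction G T

  X∈𝒞∩ℋ : ∀ k → (𝒞all ∩C (ℋ r)) (X r (suc k))
  X∈𝒞∩ℋ k = (r , 2≤r , suc k , s≤s z≤n , refl)
          , (X r (suc k) , (suc k , s≤s z≤n , refl) , InducedSub-refl {X r (suc k)})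

  ω-X : ∀ k → IsCliqueNumber (X r (suc k)) r
  ω-X k = subst (IsCliqueNumber (X r (suc k))) (m≥n⇒m⊔n≡m 2≤r)
    (∪G-cliqueNumber (G r (suc k)) (T r) (ω-G r 2≤r (suc k) (s≤s z≤n))
                     (proj₁ (proj₂ (proj₂ (T-props r 2≤r)))))

  ¬colorable-X : ∀ k → ¬ Colorable (X r (suc k)) k
  ¬colorable-X k col = 1+n≰n (χ-G r 2≤r (suc k) (s≤s z≤n) k
    (Colorable-induced {G r (suc k)} {X r (suc k)} (∪G-inducedˡ (G r (suc k)) (T r)) col))
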